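{- Let $G$ be a planar graph with a proper edge-coloring under which $G$ contains no rainbow path on $5$ vertices. Suppose $G$ contains four triangles $uwu_iu$, $i\in\{1,2,3,4\}$, sharing the edge $uw$ (with $u,w,u_1,u_2,u_3,u_4$ distinct), and let $H$ be the subgraph of $G$ formed by these four triangles. Then every vertex $x$ of $H$ is saturated, i.e. $d_H(x)=d_G(x)$.
   Context: An edge-coloring is proper if no two edges sharing a vertex receive the same color. A path is rainbow if all its edges receive distinct colors. For a subgraph $H$ of $G$, a vertex $x$ of $H$ is saturated if $d_H(x)=d_G(x)$. -}

module Defs where

open import Data.Nat as ℕ using (ℕ)
open import Data.Integer as ℤ using (ℤ; _*_; _-_; _⊓_; _⊔_; _<_; _≤_; 0ℤ)
open import Data.Fin using (Fin; zero; suc; inject₁; _≟_)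
open import Data.Bool using (Bool; true; false; T; _∧_; _∨_; if_then_else_)
open import Data.List using (List; map; allFin)
open import Data.Nat.ListAction using (sum)
open import Data.Bool.ListAction using (any)
open import Data.Product using (Σ; _×_; _,_; ∃)
open import Data.Sum using (_⊎_)
open import Function.Definitions using (Injective)
open import Relation.Binary.PropositionalEquality using (_≡_; _≢_)
open import Relation.Nullary using (¬_)
open import Relation.Nullary.Decidable using (⌊_⌋)

record Graph (n : ℕ) : Set where
  field
    adj    : Fin n → Fin n → Bool
    sym    : ∀ x y → adj x y ≡ adj y x
    irrefl : ∀ x → adj x x ≡ false

open Graph public

Edge : ∀ {n} → Graph n → Fin n → Fin n → Set
Edge G x y = T (adj G x y)

degWith : ∀ {n} → (Fin n → Fin n → Bool) → Fin n → ℕ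
degWith {n} a x = sum (map (λ y → if a x y then 1 else 0) (allFin n))

deg : ∀ {n} → Graph n → Fin n → ℕ
deg G = degWith (adj G)

-- Planarity (via plane straight-line drawings with integer coordinates)

Point : Set
Point = ℤ × ℤ

orient : Point → Point → Point → ℤ
orient (px , py) (qx , qy) (rx , ry) = ((qx - px) * (ry - py)) - ((qy - py) * (rx - px))

OnSeg : Point → Point → Point → Set
OnSeg p@(px , py) q@(qx , qy) r@(rx , ry) =
  orient p q r ≡ 0ℤ × (px ⊓ qx ≤ rx) × (rx ≤ px ⊔ qx) × (py ⊓ qy ≤ ry) × (ry ≤ py ⊔ qy)

ProperCross : Point → Point → Point → Point → Set
ProperCross p q r s = (orient p q r * orient p q s < 0ℤ) × (orient r s p * orient r s q < 0ℤ)

SegsMeet : Point → Point → Point → Point → Set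
SegsMeet p q r s =
  ProperCross p q r s ⊎ OnSeg p q r ⊎ OnSeg p q s ⊎ OnSeg r s p ⊎ OnSeg r s q

Planar : ∀ {n} → Graph n → Set
Planar {n} G = Σ (Fin n → Point) λ pos →
    Injective _≡_ _≡_ pos
  × (∀ x y z → Edge G x y → z ≢ x → z ≢ y → ¬ OnSeg (pos x) (pos y) (pos z))
  × (∀ x y z t → Edge G x y → Edge G z t →
       x ≢ z → x ≢ t → y ≢ z → y ≢ t → ¬ SegsMeet (pos x) (pos y) (pos z) (pos t))

EdgeColouring : ∀ {n} → Graph n → (Fin n → Fin n → ℕ) → Set
EdgeColouring G c = ∀ x y → Edge G x y → c x y ≡ c y x

Proper : ∀ {n} → Graph n → (Fin n → Fin n → ℕ) → Set
Proper G c = ∀ x y z → Edge G x y → Edge G x z → y ≢ z → c x y ≢ c x z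

RainbowP5 : ∀ {n} → Graph n → (Fin n → Fin n → ℕ) → Set
RainbowP5 {n} G c = Σ (Fin 5 → Fin n) λ v →
    Injective _≡_ _≡_ v
  × (∀ (i : Fin 4) → Edge G (v (inject₁ i)) (v (suc i)))
  × Injective _≡_ _≡_ (λ (i : Fin 4) → c (v (inject₁ i)) (v (suc i)))

_==_ : ∀ {n} → Fin n → Fin n → Bool
x == y = ⌊ x ≟ y ⌋

isPair : ∀ {n} → Fin n → Fin n → Fin n → Fin n → Bool
isPair a b x y = (x == a ∧ y == b) ∨ (x == b ∧ y == a)

adjH : ∀ {n} → Fin n → Fin n → (Fin 4 → Fin n) → Fin n → Fin n → Bool
adjH u w us x y =
  isPair u w x y ∨ any (λ i → isPair u (us i) x y ∨ isPair w (us i) x y) (allFin 4)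

InH : ∀ {n} → Fin n → Fin n → (Fin 4 → Fin n) → Fin n → Set
InH u w us x = x ≡ u ⊎ x ≡ w ⊎ ∃ λ (i : Fin 4) → x ≡ us i

{-# OPTIONS --safe #-}
-- Write a i = c(u uᵢ), b i = c(w uᵢ) and e = c(u w); properness makes a and b injective,
-- and a path on five vertices that is not rainbow repeats a colour on two non-consecutive
-- edges.  If y ∉ {u, w, uⱼ} is a neighbour of a spoke uᵢ and j ≠ i, the paths
-- y uᵢ u w uⱼ and y uᵢ u uⱼ w therefore force c(uᵢ y) = b j or a i = b j (otherwise
-- c(uᵢ y) = e = a j).  Since b is injective, each alternative holds for at most one j,
-- so the three indices j ≠ i cannot all be served.  When y = uₖ only two indices are
-- left, but running the argument from uᵢ and from uₖ gives c(uᵢ uₖ) = b j for both of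
-- them.  For a neighbour y ∉ H of the hub u, the path y u uᵢ w uⱼ forces
-- c(u y) ∈ {b i, b j} or a i = b j, and the same pigeonhole gives c(u y) = b i for
-- every i.
module Submission where

open import Defs
open import Data.Nat using (ℕ)
open import Data.Fin using (Fin; zero; suc; inject₁; punchIn)
open import Function.Definitions using (Injective)
open import Relation.Binary.PropositionalEquality using (_≡_; _≢_)
open import Relation.Nullary using (¬_)

import Data.Nat.Properties as ℕ
import Data.Fin.Properties as Fin
open import Data.Fin.Properties using (punchIn-injective; punchInᵢ≢i; any?)
open import Data.Bool using (Bool; true; false; T; _∧_; _∨_; if_then_else_)
open import Data.Bool.Properties using (T-∧; T-∨)
open import Data.Empty using (⊥; ⊥-elim)
open import Data.List using (allFin)
open import Data.List.Properties using (map-cong)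
open import Data.List.Membership.Propositional using (lose)
open import Data.List.Membership.Propositional.Properties using (∈-allFin)
open import Data.List.Relation.Unary.Any using (satisfied)
open import Data.List.Relation.Unary.Any.Properties using (any⁺; any⁻)
open import Data.Nat.ListAction using (sum)
open import Data.Bool.ListAction using (any)
open import Data.Product using (_×_; _,_; ∃; proj₁; proj₂)
import Data.Product as Product
open import Data.Sum using (_⊎_; inj₁; inj₂; [_,_])
open import Data.Vec using (Vec; []; _∷_; lookup)
open import Data.Vec.Relation.Unary.All using ([]; _∷_)
open import Data.Vec.Relation.Unary.AllPairs using ([]; _∷_)
open import Data.Vec.Relation.Unary.Unique.Propositional using (Unique)
open import Data.Vec.Relation.Unary.Unique.Propositional.Properties using (lookup-injective)
open import Function using (_∘_; id; case_of_; _⇔_; Equivalence)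
open import Relation.Binary.PropositionalEquality using (refl; trans; cong; subst; ≢-sym)
import Relation.Binary.PropositionalEquality as ≡
open import Relation.Nullary using (yes; no)
open import Relation.Nullary.Decidable using (decidable-stable; toWitness; fromWitness)

T-injective : ∀ {x y : Bool} → (T x → T y) → (T y → T x) → x ≡ y
T-injective {false} {false} _ _ = refl
T-injective {false} {true}  _ g = ⊥-elim (g _)
T-injective {true}  {false} f _ = ⊥-elim (f _)
T-injective {true}  {true}  _ _ = refl

degWith-cong : ∀ {n} {a a′ : Fin n → Fin n → Bool} x →
  (∀ y → a x y ≡ a′ x y) → degWith a x ≡ degWith a′ x
degWith-cong {n} x eq = cong sum (map-cong (λ y → cong (λ t → if t then 1 else 0) (eq y)) (allFin n))

module _ {A : Set} {x z : A} where

  pigeonhole₃ : ∀ {g : Fin 3 → A} → Injective _≡_ _≡_ g → ¬ (∀ t → x ≡ g t ⊎ z ≡ g t)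
  pigeonhole₃ g-injective hit with hit zero | hit (suc zero) | hit (suc (suc zero))
  ... | inj₁ p | inj₁ q | _      = case g-injective (trans (≡.sym p) q) of λ ()
  ... | inj₂ p | inj₂ q | _      = case g-injective (trans (≡.sym p) q) of λ ()
  ... | inj₁ p | inj₂ _ | inj₁ r = case g-injective (trans (≡.sym p) r) of λ ()
  ... | inj₂ p | inj₁ _ | inj₂ r = case g-injective (trans (≡.sym p) r) of λ ()
  ... | _      | inj₁ q | inj₁ r = case g-injective (trans (≡.sym q) r) of λ ()
  ... | _      | inj₂ q | inj₂ r = case g-injective (trans (≡.sym q) r) of λ ()

  pigeonhole-punctured : ∀ {b : Fin 4 → A} → Injective _≡_ _≡_ b →
    ∀ i → ¬ (∀ j → j ≢ i → x ≡ b j ⊎ z ≡ b j)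
  pigeonhole-punctured {b} b-injective i hit =
    pigeonhole₃ {g = b ∘ punchIn i} (punchIn-injective i _ _ ∘ b-injective)
                (λ t → hit (punchIn i t) (punchInᵢ≢i i t))

module _ {n : ℕ} (G : Graph n) where

  Edge-sym : ∀ {x y} → Edge G x y → Edge G y x
  Edge-sym {x} {y} = subst T (Graph.sym G x y)

  Edge-irrefl : ∀ {x y} → Edge G x y → x ≢ y
  Edge-irrefl {x} xx refl = subst T (irrefl G x) xx

module NonRainbowPaths {n} (G : Graph n) (c : Fin n → Fin n → ℕ)
  (colouring : EdgeColouring G c) (proper : Proper G c) (no-rainbow : ¬ RainbowP5 G c) where

  infix 4 _—[_]—_
  _—[_]—_ : Fin n → ℕ → Fin n → Set
  x —[ k ]— y = Edge G x y × c x y ≡ k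

  flip-edge : ∀ {x y k} → x —[ k ]— y → y —[ k ]— x
  flip-edge {x} {y} (xy , refl) = Edge-sym G xy , ≡.sym (colouring x y xy)

  proper-at : ∀ {x y z k l} → x —[ k ]— y → x —[ l ]— z → y ≢ z → k ≢ l
  proper-at (xy , refl) (xz , refl) = proper _ _ _ xy xz

  consecutive-colours-differ : ∀ {x y z k l} → x —[ k ]— y → y —[ l ]— z → x ≢ z → k ≢ l
  consecutive-colours-differ xy = proper-at (flip-edge xy)

  repeated-colour : ∀ {v₀ v₁ v₂ v₃ v₄ k₀ k₁ k₂ k₃} →
    v₀ —[ k₀ ]— v₁ → v₁ —[ k₁ ]— v₂ → v₂ —[ k₂ ]— v₃ → v₃ —[ k₃ ]— v₄ →
    v₀ ≢ v₂ → v₀ ≢ v₃ → v₀ ≢ v₄ → v₁ ≢ v₃ → v₁ ≢ v₄ → v₂ ≢ v₄ →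
    k₀ ≡ k₂ ⊎ k₀ ≡ k₃ ⊎ k₁ ≡ k₃
  repeated-colour {v₀} {v₁} {v₂} {v₃} {v₄} {k₀} {k₁} {k₂} {k₃}
                  e₀ e₁ e₂ e₃ v₀≢v₂ v₀≢v₃ v₀≢v₄ v₁≢v₃ v₁≢v₄ v₂≢v₄
    with k₀ ℕ.≟ k₂ | k₀ ℕ.≟ k₃ | k₁ ℕ.≟ k₃
  ... | yes k₀≡k₂ | _         | _         = inj₁ k₀≡k₂
  ... | no _      | yes k₀≡k₃ | _         = inj₂ (inj₁ k₀≡k₃)
  ... | no _      | no _      | yes k₁≡k₃ = inj₂ (inj₂ k₁≡k₃)
  ... | no k₀≢k₂  | no k₀≢k₃  | no k₁≢k₃  =
    ⊥-elim (no-rainbow (lookup vs , lookup-injective vs-unique _ _ , proj₁ ∘ steps , colours-injective))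
    where
    vs : Vec (Fin n) 5
    vs = v₀ ∷ v₁ ∷ v₂ ∷ v₃ ∷ v₄ ∷ []

    ks : Vec ℕ 4
    ks = k₀ ∷ k₁ ∷ k₂ ∷ k₃ ∷ []

    steps : ∀ i → lookup vs (inject₁ i) —[ lookup ks i ]— lookup vs (suc i)
    steps zero                   = e₀
    steps (suc zero)             = e₁
    steps (suc (suc zero))       = e₂
    steps (suc (suc (suc zero))) = e₃

    vs-unique : Unique vs
    vs-unique = (Edge-irrefl G (proj₁ e₀) ∷ v₀≢v₂ ∷ v₀≢v₃ ∷ v₀≢v₄ ∷ [])
              ∷ (Edge-irrefl G (proj₁ e₁) ∷ v₁≢v₃ ∷ v₁≢v₄ ∷ [])
              ∷ (Edge-irrefl G (proj₁ e₂) ∷ v₂≢v₄ ∷ [])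
              ∷ (Edge-irrefl G (proj₁ e₃) ∷ [])
              ∷ [] ∷ []

    ks-unique : Unique ks
    ks-unique = (consecutive-colours-differ e₀ e₁ v₀≢v₂ ∷ k₀≢k₂ ∷ k₀≢k₃ ∷ [])
              ∷ (consecutive-colours-differ e₁ e₂ v₁≢v₃ ∷ k₁≢k₃ ∷ [])
              ∷ (consecutive-colours-differ e₂ e₃ v₂≢v₄ ∷ [])
              ∷ [] ∷ []

    colours-injective : Injective _≡_ _≡_ (λ i → c (lookup vs (inject₁ i)) (lookup vs (suc i)))
    colours-injective {i} {j} eq =
      lookup-injective ks-unique i j (trans (≡.sym (proj₂ (steps i))) (trans eq (proj₂ (steps j))))

module FourTriangles {n} (G : Graph n) (c : Fin n → Fin n → ℕ)
  (colouring : EdgeColouring G c) (proper : Proper G c) (no-rainbow : ¬ RainbowP5 G c)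
  {u w : Fin n} {us : Fin 4 → Fin n}
  (u≢w : u ≢ w) (us-injective : Injective _≡_ _≡_ us)
  (us≢u : ∀ i → us i ≢ u) (us≢w : ∀ i → us i ≢ w)
  (uw : Edge G u w) (u-us : ∀ i → Edge G u (us i)) (w-us : ∀ i → Edge G w (us i)) where

  open NonRainbowPaths G c colouring proper no-rainbow

  e : ℕ
  e = c u w

  a : Fin 4 → ℕ
  a i = c u (us i)

  b : Fin 4 → ℕ
  b i = c w (us i)

  edge-uw : u —[ e ]— w
  edge-uw = uw , refl

  edge-u : ∀ i → u —[ a i ]— us i
  edge-u i = u-us i , refl

  edge-w : ∀ i → w —[ b i ]— us i
  edge-w i = w-us i , refl

  spokes-distinct : ∀ {i j} → i ≢ j → us i ≢ us j
  spokes-distinct i≢j = i≢j ∘ us-injective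

  spoke-colours-injective : ∀ {x} → (∀ i → Edge G x (us i)) → Injective _≡_ _≡_ (λ i → c x (us i))
  spoke-colours-injective x-us {i} {j} eq =
    decidable-stable (i Fin.≟ j) λ i≢j → proper-at (x-us i , refl) (x-us j , refl) (spokes-distinct i≢j) eq

  a-injective : Injective _≡_ _≡_ a
  a-injective = spoke-colours-injective u-us

  b-injective : Injective _≡_ _≡_ b
  b-injective = spoke-colours-injective w-us

  spoke-neighbour-colour : ∀ {i j y d} → us i —[ d ]— y →
    y ≢ u → y ≢ w → j ≢ i → y ≢ us j → d ≡ b j ⊎ a i ≡ b j
  spoke-neighbour-colour {i} {j} iy y≢u y≢w j≢i y≢uⱼ
    with repeated-colour (flip-edge iy) (flip-edge (edge-u i)) edge-uw (edge-w j)
           y≢u y≢w y≢uⱼ (us≢w i) (spokes-distinct (≢-sym j≢i)) (≢-sym (us≢u j))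
       | repeated-colour (flip-edge iy) (flip-edge (edge-u i)) (edge-u j) (flip-edge (edge-w j))
           y≢u y≢uⱼ y≢w (spokes-distinct (≢-sym j≢i)) (us≢w i) u≢w
  ... | inj₂ hit | _        = hit
  ... | _        | inj₂ hit = hit
  ... | inj₁ d≡e | inj₁ d≡aⱼ =
    ⊥-elim (proper-at edge-uw (edge-u j) (≢-sym (us≢w j)) (trans (≡.sym d≡e) d≡aⱼ))

  hub-has-no-outer-neighbour : ∀ {y d} → u —[ d ]— y → y ≢ w → (∀ k → y ≢ us k) → ⊥
  hub-has-no-outer-neighbour {d = d} uy y≢w y∉us =
    Fin.0≢1+n (b-injective (trans (≡.sym (d≡b zero)) (d≡b (suc zero))))
    where
    d≡b : ∀ i → d ≡ b i
    d≡b i = decidable-stable (d ℕ.≟ b i) λ d≢bᵢ →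
      pigeonhole-punctured b-injective i λ j j≢i →
        [ ⊥-elim ∘ d≢bᵢ , id ]
          (repeated-colour (flip-edge uy) (edge-u i) (flip-edge (edge-w i)) (edge-w j)
             (y∉us i) y≢w (y∉us j) u≢w (≢-sym (us≢u j)) (spokes-distinct (≢-sym j≢i)))

  spoke-has-no-outer-neighbour : ∀ {i y d} → us i —[ d ]— y →
    y ≢ u → y ≢ w → (∀ k → y ≢ us k) → ⊥
  spoke-has-no-outer-neighbour {i} iy y≢u y≢w y∉us =
    pigeonhole-punctured b-injective i λ j j≢i → spoke-neighbour-colour iy y≢u y≢w j≢i (y∉us j)

  spokes-nonadjacent : ∀ {i k d} → i ≢ k → ¬ (us i —[ d ]— us k)
  spokes-nonadjacent {i} {k} {d} i≢k ik = pigeonhole-punctured b-injective i hit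
    where
    d≡b : ∀ {j} → j ≢ i → j ≢ k → d ≡ b j
    d≡b {j} j≢i j≢k
      with spoke-neighbour-colour ik (us≢u k) (us≢w k) j≢i (spokes-distinct (≢-sym j≢k))
         | spoke-neighbour-colour (flip-edge ik) (us≢u i) (us≢w i) j≢k (spokes-distinct (≢-sym j≢i))
    ... | inj₁ d≡bⱼ  | _          = d≡bⱼ
    ... | _          | inj₁ d≡bⱼ  = d≡bⱼ
    ... | inj₂ aᵢ≡bⱼ | inj₂ aₖ≡bⱼ = ⊥-elim (i≢k (a-injective (trans aᵢ≡bⱼ (≡.sym aₖ≡bⱼ))))

    hit : ∀ j → j ≢ i → d ≡ b j ⊎ b k ≡ b j
    hit j j≢i with j Fin.≟ k
    ... | yes refl = inj₂ refl
    ... | no j≢k   = inj₁ (d≡b j≢i j≢k)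

  hub-neighbours : ∀ {y} → Edge G u y → y ≡ w ⊎ ∃ λ k → y ≡ us k
  hub-neighbours {y} uy with y Fin.≟ w | any? (λ k → y Fin.≟ us k)
  ... | yes y≡w | _        = inj₁ y≡w
  ... | no _    | yes y∈us = inj₂ y∈us
  ... | no y≢w  | no y∉us  =
    ⊥-elim (hub-has-no-outer-neighbour (uy , refl) y≢w λ k y≡uₖ → y∉us (k , y≡uₖ))

  spoke-neighbours : ∀ {i y} → Edge G (us i) y → y ≡ u ⊎ y ≡ w
  spoke-neighbours {y = y} iy with y Fin.≟ u | y Fin.≟ w | any? (λ k → y Fin.≟ us k)
  ... | yes y≡u | _       | _             = inj₁ y≡u
  ... | no _    | yes y≡w | _             = inj₂ y≡w
  ... | no _    | no _    | yes (k , refl) =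
    ⊥-elim (spokes-nonadjacent (λ { refl → Edge-irrefl G iy refl }) (iy , refl))
  ... | no y≢u  | no y≢w  | no y∉us       =
    ⊥-elim (spoke-has-no-outer-neighbour (iy , refl) y≢u y≢w λ k y≡uₖ → y∉us (k , y≡uₖ))

module _ {n : ℕ} where

  ==-refl : ∀ (x : Fin n) → T (x == x)
  ==-refl x = fromWitness {a? = x Fin.≟ x} refl

  ∧-==-sound : ∀ (x a y b : Fin n) → T ((x == a) ∧ (y == b)) → x ≡ a × y ≡ b
  ∧-==-sound x a y b =
    Product.map (toWitness {a? = x Fin.≟ a}) (toWitness {a? = y Fin.≟ b}) ∘ Equivalence.to (T-∧ {x == a} {y == b})

  isPair-here : ∀ p q → T (isPair p q p q)
  isPair-here p q = Equivalence.from (T-∨ {(p == p) ∧ (q == q)} {(p == q) ∧ (q == p)})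
                      (inj₁ (Equivalence.from (T-∧ {p == p} {q == q}) (==-refl p , ==-refl q)))

  isPair-swap : ∀ p q → T (isPair p q q p)
  isPair-swap p q = Equivalence.from (T-∨ {(q == p) ∧ (p == q)} {(q == q) ∧ (p == p)})
                      (inj₂ (Equivalence.from (T-∧ {q == q} {p == p}) (==-refl q , ==-refl p)))

  isPair-edge : ∀ (G : Graph n) {p q} x y → Edge G p q → T (isPair p q x y) → Edge G x y
  isPair-edge G {p} {q} x y pq t with Equivalence.to (T-∨ {(x == p) ∧ (y == q)} {(x == q) ∧ (y == p)}) t
  ... | inj₁ t-pq = case ∧-==-sound x p y q t-pq of λ where (refl , refl) → pq
  ... | inj₂ t-qp = case ∧-==-sound x q y p t-qp of λ where (refl , refl) → Edge-sym G pq

module SubgraphH {n} (u w : Fin n) (us : Fin 4 → Fin n) where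

  spoke-pairs : Fin n → Fin n → Fin 4 → Bool
  spoke-pairs x y i = isPair u (us i) x y ∨ isPair w (us i) x y

  T-adjH : ∀ x y → T (adjH u w us x y) ⇔ (T (isPair u w x y) ⊎ T (any (spoke-pairs x y) (allFin 4)))
  T-adjH x y = T-∨ {isPair u w x y} {any (spoke-pairs x y) (allFin 4)}

  T-spoke-pairs : ∀ x y i → T (spoke-pairs x y i) ⇔ (T (isPair u (us i) x y) ⊎ T (isPair w (us i) x y))
  T-spoke-pairs x y i = T-∨ {isPair u (us i) x y} {isPair w (us i) x y}

  adjH-uw : ∀ x y → T (isPair u w x y) → T (adjH u w us x y)
  adjH-uw x y = Equivalence.from (T-adjH x y) ∘ inj₁

  adjH-spoke : ∀ x y i → T (isPair u (us i) x y) ⊎ T (isPair w (us i) x y) → T (adjH u w us x y)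
  adjH-spoke x y i =
    Equivalence.from (T-adjH x y) ∘ inj₂ ∘ any⁺ (spoke-pairs x y) ∘ lose (∈-allFin i)
    ∘ Equivalence.from (T-spoke-pairs x y i)

  adjH-⊆ : ∀ (G : Graph n) → Edge G u w → (∀ i → Edge G u (us i)) → (∀ i → Edge G w (us i)) →
    ∀ {x y} → T (adjH u w us x y) → Edge G x y
  adjH-⊆ G uw u-us w-us {x} {y} t with Equivalence.to (T-adjH x y) t
  ... | inj₁ t-uw = isPair-edge G x y uw t-uw
  ... | inj₂ t-us with satisfied (any⁻ (spoke-pairs x y) (allFin 4) t-us)
  ... | i , t-i =
    [ isPair-edge G x y (u-us i) , isPair-edge G x y (w-us i) ] (Equivalence.to (T-spoke-pairs x y i) t-i)

lemma7 : ∀ {n} (G : Graph n) (c : Fin n → Fin n → ℕ) →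
    Planar G → EdgeColouring G c → Proper G c → ¬ RainbowP5 G c →
    (u w : Fin n) (us : Fin 4 → Fin n) →
    u ≢ w → Injective _≡_ _≡_ us → (∀ i → us i ≢ u) → (∀ i → us i ≢ w) →
    Edge G u w → (∀ i → Edge G u (us i)) → (∀ i → Edge G w (us i)) →
    ∀ x → InH u w us x → degWith (adjH u w us) x ≡ deg G x
lemma7 G c _ colouring proper no-rainbow u w us u≢w us-injective us≢u us≢w uw u-us w-us x x∈H =
  degWith-cong {a = adjH u w us} {a′ = adj G} x λ y →
    T-injective (adjH-⊆ G uw u-us w-us) (saturated x∈H)
  where
  open SubgraphH u w us
  module U = FourTriangles G c colouring proper no-rainbow u≢w us-injective us≢u us≢w uw u-us w-us
  module W = FourTriangles G c colouring proper no-rainbow (≢-sym u≢w) us-injective us≢w us≢u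
                           (Edge-sym G uw) w-us u-us

  saturated : ∀ {v y} → InH u w us v → Edge G v y → T (adjH u w us v y)
  saturated (inj₁ refl) uy with U.hub-neighbours uy
  ... | inj₁ refl       = adjH-uw u w (isPair-here u w)
  ... | inj₂ (k , refl) = adjH-spoke u (us k) k (inj₁ (isPair-here u (us k)))
  saturated (inj₂ (inj₁ refl)) wy with W.hub-neighbours wy
  ... | inj₁ refl       = adjH-uw w u (isPair-swap u w)
  ... | inj₂ (k , refl) = adjH-spoke w (us k) k (inj₂ (isPair-here w (us k)))
  saturated (inj₂ (inj₂ (i , refl))) iy with U.spoke-neighbours iy
  ... | inj₁ refl = adjH-spoke (us i) u i (inj₁ (isPair-swap u (us i)))
  ... | inj₂ refl = adjH-spoke (us i) w i (inj₂ (isPair-swap w (us i)))
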